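{- Let $k\ge4$, $n=2k-1$, $\lambda\in\overline{\mathcal{U}}_{T_n}$, let $Y_{S_\lambda}$ be its Keith--Nath Young diagram with hook lengths $h_{i,j}$, and let $z$ be the integer with $h_{1,z+1}=n-2$. Then: (1) the cell in row $z+1$ and column $z+1$ does not belong to $Y_{S_\lambda}$; (2) the column $z+1$ of $Y_{S_\lambda}$ contains exactly $z$ cells; (3) the main diagonal of $Y_{S_\lambda}$ contains exactly $z$ cells.
   Context: Partitions into distinct parts: $\lambda=(\lambda_1<\dots<\lambda_t)$, $t\ge2$. Missing parts $\mathcal{M}_\lambda=\{1,\dots,\lambda_t\}\setminus\{\lambda_i\}$. Unrefinable: no two distinct missing parts sum to a part. Maximal: largest part is maximum among unrefinable partitions of the same integer. $\overline{\mathcal{U}}_N$: maximal unrefinable partitions of $N$ with $\#\mathcal{M}_\lambda=\lfloor\lambda_t/2\rfloor$. $T_n=n(n+1)/2$. $S_\lambda=\mathbb{N}_0\setminus\lambda$; $Y_{S_\lambda}$ (English convention) has one row per part $g$ of $\lambda$, ordered top to bottom by decreasing $g$, the row of $g$ having $\#\{s\in S_\lambda:s<g\}$ cells. $h_{i,j}$ is the hook length (arm + leg + 1) of the cell in row $i$, column $j$. -}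

module Defs where

open import Data.Nat using (ℕ; zero; suc; _+_; _*_; _∸_; _≤_; _<_; _⊔_; ⌊_/2⌋; _≤?_; _≟_)
open import Data.List using (List; []; _∷_; length; filter; applyUpTo; upTo; map; reverse; foldr)
open import Data.Nat.ListAction using (sum)
open import Data.List.Membership.Propositional using (_∈_; _∉_)
open import Data.List.Membership.DecPropositional _≟_ using (_∈?_)
open import Data.List.Relation.Unary.All using (All)
open import Data.List.Relation.Unary.Linked using (Linked)
open import Data.Product using (_×_; ∃₂)
open import Relation.Nullary using (¬_; ¬?)
open import Relation.Binary.PropositionalEquality using (_≡_; _≢_)

T : ℕ → ℕ
T n = ⌊ n * suc n /2⌋

record IsDistinctPartition (N : ℕ) (λs : List ℕ) : Set where
  field
    increasing : Linked _<_ λs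
    positive   : All (λ p → 1 ≤ p) λs
    atLeastTwo : 2 ≤ length λs
    sumIs      : sum λs ≡ N

largest : List ℕ → ℕ
largest = foldr _⊔_ 0

Missing : List ℕ → ℕ → Set
Missing λs m = 1 ≤ m × m ≤ largest λs × m ∉ λs

missingList : List ℕ → List ℕ
missingList λs = filter (λ m → ¬? (m ∈? λs)) (applyUpTo suc (largest λs))

Unrefinable : List ℕ → Set
Unrefinable λs = ¬ (∃₂ λ a b → a ≢ b × Missing λs a × Missing λs b × (a + b) ∈ λs)

IsUnrefinablePartition : ℕ → List ℕ → Set
IsUnrefinablePartition N λs = IsDistinctPartition N λs × Unrefinable λs

IsMaximalUnrefinable : ℕ → List ℕ → Set
IsMaximalUnrefinable N λs =
  IsUnrefinablePartition N λs ×
  (∀ μ → IsUnrefinablePartition N μ → largest μ ≤ largest λs)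

InUbar : ℕ → List ℕ → Set
InUbar N λs = IsMaximalUnrefinable N λs × length (missingList λs) ≡ ⌊ largest λs /2⌋

-- Young diagram Y_{S_λ}, S_λ = ℕ₀ \ λ.  The row of part g has
-- #{s ∈ S_λ : s < g} cells; rows ordered top to bottom by decreasing g.
rowOfPart : List ℕ → ℕ → ℕ
rowOfPart λs g = length (filter (λ s → ¬? (s ∈? λs)) (upTo g))

rowLengths : List ℕ → List ℕ
rowLengths λs = map (rowOfPart λs) (reverse λs)

-- 0-based list lookup with default 0
nth : List ℕ → ℕ → ℕ
nth []       _       = 0
nth (x ∷ xs) zero    = x
nth (x ∷ xs) (suc i) = nth xs i

-- length of row i (rows numbered 1, …, t from top); 0 outside
rowLen : List ℕ → ℕ → ℕ
rowLen λs zero    = 0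
rowLen λs (suc i) = nth (rowLengths λs) i

numRows : List ℕ → ℕ
numRows λs = length λs

InY : List ℕ → ℕ → ℕ → Set
InY λs i j = 1 ≤ i × i ≤ numRows λs × 1 ≤ j × j ≤ rowLen λs i

rowIdx : List ℕ → List ℕ
rowIdx λs = applyUpTo suc (numRows λs)

arm : List ℕ → ℕ → ℕ → ℕ
arm λs i j = rowLen λs i ∸ j

leg : List ℕ → ℕ → ℕ → ℕ
leg λs i j = length (filter (λ i' → suc i ≤? i') (filter (λ i' → j ≤? rowLen λs i') (rowIdx λs)))

hook : List ℕ → ℕ → ℕ → ℕ
hook λs i j = arm λs i j + leg λs i j + 1

colLen : List ℕ → ℕ → ℕ
colLen λs j = length (filter (λ i → j ≤? rowLen λs i) (rowIdx λs))

diagLen : List ℕ → ℕ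
diagLen λs = length (filter (λ i → i ≤? rowLen λs i) (rowIdx λs))

module Submission where

-- Put p = n − 2 = 2k − 3, so N = T (p + 2), and let L be the largest part. The
-- partition [1 … p−1] ∪ {p+3, 2p} is unrefinable (its missing parts are ≥ p), so
-- maximality gives L ≥ 2p. Since ⌊L/2⌋ of 1 … L are missing, exactly ⌈L/2⌉ are
-- parts: if L ≥ 2p+3 their sum is at least T (p+1) + L > T (p+2); if L = 2p+2,
-- unrefinability leaves exactly one of a, L − a in λ for every a ≤ p, and as
-- a ≡ L − a (mod 2) the sum has the parity of T p + L, not of T (p+2). Hence
-- ⌊L/2⌋ = p and the first row has p + 1 cells, so h₁,z+1 = p says that column
-- z+1 has z cells. The rows weakly decrease, so rows 1 … z are exactly the rows
-- longer than z; this gives (1) and (3).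

open import Data.Nat
open import Data.Nat.Properties
open import Data.Nat.ListAction using (sum)
open import Data.Nat.ListAction.Properties using (sum-++)
open import Data.Nat.Tactic.RingSolver using (solve-∀)
open import Data.List using (List; []; _∷_; length; filter; applyUpTo; _++_; reverse; reverseAcc; map)
open import Data.List.Properties
  using (applyUpTo-∷ʳ; filter-++; filter-all; filter-accept; filter-reject; length-++; length-filter; length-applyUpTo)
open import Data.List.Membership.Propositional using (_∈_; _∉_)
open import Data.List.Membership.Propositional.Properties using (∈-++⁺ˡ; ∈-++⁺ʳ; ∈-applyUpTo⁺)
open import Data.List.Membership.DecPropositional _≟_ using (_∈?_)
open import Data.List.Relation.Unary.Any using (here; there)
open import Data.List.Relation.Unary.All as All using (All; []; _∷_)
import Data.List.Relation.Unary.All.Properties as AllP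
open import Data.List.Relation.Unary.Linked as Linked using (Linked; []; [-]; _∷_)
import Data.List.Relation.Unary.Linked.Properties as LinkedP
open import Data.Product using (_×_; _,_; proj₁; proj₂; ∃-syntax)
open import Data.Sum using (_⊎_; inj₁; inj₂)
open import Function using (_∘_; flip)
open import Relation.Nullary using (Dec; yes; no; ¬_; ¬?; contradiction)
open import Relation.Unary using (Pred; Decidable)
open import Relation.Binary.Core using (Rel)
open import Relation.Binary.Definitions using (tri<; tri≈; tri>)
open import Relation.Binary.PropositionalEquality
open import Algebra.Properties.CommutativeSemigroup +-commutativeSemigroup
  using () renaming (interchange to +-interchange)
open import Defs

-- Sums over [1, n] and triangular numbers

∑ : ℕ → (ℕ → ℕ) → ℕ
∑ zero    f = 0
∑ (suc n) f = ∑ n f + f (suc n)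

∑-cong : ∀ n {f g : ℕ → ℕ} → (∀ x → 1 ≤ x → x ≤ n → f x ≡ g x) → ∑ n f ≡ ∑ n g
∑-cong zero    f≗g = refl
∑-cong (suc n) f≗g =
  cong₂ _+_ (∑-cong n (λ x 1≤x x≤n → f≗g x 1≤x (m≤n⇒m≤1+n x≤n))) (f≗g (suc n) (s≤s z≤n) ≤-refl)

∑-+ : ∀ n (f g : ℕ → ℕ) → ∑ n (λ x → f x + g x) ≡ ∑ n f + ∑ n g
∑-+ zero    f g = refl
∑-+ (suc n) f g = begin
  ∑ n (λ x → f x + g x) + (f (suc n) + g (suc n)) ≡⟨ cong (_+ (f (suc n) + g (suc n))) (∑-+ n f g) ⟩
  ∑ n f + ∑ n g + (f (suc n) + g (suc n))         ≡⟨ +-interchange (∑ n f) (∑ n g) _ _ ⟩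
  ∑ n f + f (suc n) + (∑ n g + g (suc n))         ∎
  where open ≡-Reasoning

∑-*ˡ : ∀ n c (f : ℕ → ℕ) → ∑ n (λ x → c * f x) ≡ c * ∑ n f
∑-*ˡ zero    c f = sym (*-zeroʳ c)
∑-*ˡ (suc n) c f = trans (cong (_+ c * f (suc n)) (∑-*ˡ n c f)) (sym (*-distribˡ-+ c (∑ n f) _))

∑-const : ∀ n c → ∑ n (λ _ → c) ≡ n * c
∑-const zero    c = refl
∑-const (suc n) c = trans (cong (_+ c) (∑-const n c)) (+-comm (n * c) c)

∑-shift : ∀ n (f : ℕ → ℕ) → ∑ (suc n) f ≡ f 1 + ∑ n (λ x → f (suc x))
∑-shift zero    f = +-comm 0 (f 1)
∑-shift (suc n) f = trans (cong (_+ f (suc (suc n))) (∑-shift n f)) (+-assoc (f 1) _ _)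

∑-reflect : ∀ n (g : ℕ → ℕ) →
  ∑ (suc (n + n)) g ≡ ∑ n (λ a → g a + g (suc (suc (n + n)) ∸ a)) + g (suc n)
∑-reflect zero    g = refl
∑-reflect (suc n) g rewrite +-suc n n = begin
  ∑ (2 + m) g + g (3 + m)
    ≡⟨ cong (_+ g (3 + m)) (∑-shift (suc m) g) ⟩
  g 1 + ∑ (1 + m) (λ x → g (suc x)) + g (3 + m)
    ≡⟨ cong (λ s → g 1 + s + g (3 + m)) (∑-reflect n (λ x → g (suc x))) ⟩
  g 1 + (∑ n (λ a → g (suc a) + g (suc (2 + m ∸ a))) + g (2 + n)) + g (3 + m)
    ≡⟨ cong (λ s → g 1 + (s + g (2 + n)) + g (3 + m)) (∑-cong n pair-shift) ⟩
  g 1 + (∑ n (λ a → h (suc a)) + g (2 + n)) + g (3 + m)         ≡⟨ rearrange (g 1) _ (g (2 + n)) (g (3 + m)) ⟩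
  g 1 + g (3 + m) + ∑ n (λ a → h (suc a)) + g (2 + n)           ≡⟨ cong (_+ g (2 + n)) (sym (∑-shift n h)) ⟩
  ∑ (suc n) h + g (2 + n)                                        ∎
  where
  open ≡-Reasoning
  m = n + n
  h : ℕ → ℕ
  h a = g a + g (4 + m ∸ a)
  pair-shift : ∀ a → 1 ≤ a → a ≤ n → g (suc a) + g (suc (2 + m ∸ a)) ≡ h (suc a)
  pair-shift a _ a≤n =
    cong (λ b → g (suc a) + g b) (sym (+-∸-assoc 1 (≤-trans a≤n (≤-trans (m≤m+n n n) (m≤n+m m 2)))))
  rearrange : ∀ a b c d → a + (b + c) + d ≡ a + d + b + c
  rearrange = solve-∀

∑-tight : ∀ n (f : ℕ → ℕ) r → (∀ x → 1 ≤ x → x ≤ n → 1 ≤ f x) → ∑ n f + r ≡ n →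
          r ≡ 0 × (∀ x → 1 ≤ x → x ≤ n → f x ≡ 1)
∑-tight zero    f r _   eq = eq , λ x 1≤x x≤0 → contradiction (≤-trans 1≤x x≤0) λ ()
∑-tight (suc n) f r f≥1 eq = m+n≡0⇒n≡0 d r≡0 , f≡1
  where
  d = f (suc n) ∸ 1
  f[1+n]≥1 = f≥1 (suc n) (s≤s z≤n) ≤-refl
  eq′ : ∑ n f + (d + r) ≡ n
  eq′ = suc-injective (begin
    suc (∑ n f + (d + r))    ≡⟨ regroup (∑ n f) d r ⟩
    ∑ n f + suc d + r        ≡⟨ cong (λ y → ∑ n f + y + r) (m+[n∸m]≡n f[1+n]≥1) ⟩
    ∑ n f + f (suc n) + r    ≡⟨ eq ⟩
    suc n                    ∎)
    where
    open ≡-Reasoning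
    regroup : ∀ a b c → suc (a + (b + c)) ≡ a + suc b + c
    regroup = solve-∀
  IH = ∑-tight n f (d + r) (λ x 1≤x x≤n → f≥1 x 1≤x (m≤n⇒m≤1+n x≤n)) eq′
  r≡0 = proj₁ IH
  f≡1 : ∀ x → 1 ≤ x → x ≤ suc n → f x ≡ 1
  f≡1 x 1≤x x≤1+n with m≤n⇒m<n∨m≡n x≤1+n
  ... | inj₁ x≤n  = proj₂ IH x 1≤x (≤-pred x≤n)
  ... | inj₂ refl = ≤-antisym (m∸n≡0⇒m≤n (m+n≡0⇒m≡0 d r≡0)) f[1+n]≥1

⌊m+m+n/2⌋≡m+⌊n/2⌋ : ∀ m n → ⌊ m + m + n /2⌋ ≡ m + ⌊ n /2⌋
⌊m+m+n/2⌋≡m+⌊n/2⌋ zero    n = refl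
⌊m+m+n/2⌋≡m+⌊n/2⌋ (suc m) n rewrite +-suc m m = cong suc (⌊m+m+n/2⌋≡m+⌊n/2⌋ m n)

T-suc : ∀ n → T (suc n) ≡ T n + suc n
T-suc n = begin
  ⌊ suc n * suc (suc n) /2⌋           ≡⟨ cong ⌊_/2⌋ (expand n) ⟩
  ⌊ suc n + suc n + n * suc n /2⌋     ≡⟨ ⌊m+m+n/2⌋≡m+⌊n/2⌋ (suc n) (n * suc n) ⟩
  suc n + T n                         ≡⟨ +-comm (suc n) (T n) ⟩
  T n + suc n                         ∎
  where
  open ≡-Reasoning
  expand : ∀ n → suc n * suc (suc n) ≡ suc n + suc n + n * suc n
  expand = solve-∀

T-mono-≤ : ∀ {m n} → m ≤ n → T m ≤ T n
T-mono-≤ m≤n = ⌊n/2⌋-mono (*-mono-≤ m≤n (s≤s m≤n))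

∑-id : ∀ n → ∑ n (λ x → x) ≡ T n
∑-id zero    = refl
∑-id (suc n) = trans (cong (_+ suc n) (∑-id n)) (sym (T-suc n))

-- Counting with indicators

χ : ∀ {ℓ} {P : Set ℓ} → Dec P → ℕ
χ (yes _) = 1
χ (no _)  = 0

module _ {ℓ} {P : Set ℓ} where

  χ-yes : (P? : Dec P) → P → χ P? ≡ 1
  χ-yes (yes _) _  = refl
  χ-yes (no ¬p) p = contradiction p ¬p

  χ-no : (P? : Dec P) → ¬ P → χ P? ≡ 0
  χ-no (yes p) ¬p = contradiction p ¬p
  χ-no (no _)  _  = refl

  χ-¬ : (P? : Dec P) → χ (¬? P?) + χ P? ≡ 1
  χ-¬ (yes _) = refl
  χ-¬ (no _)  = refl

  χ-cong : ∀ {ℓ′} {Q : Set ℓ′} (P? : Dec P) (Q? : Dec Q) → (P → Q) → (Q → P) → χ P? ≡ χ Q?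
  χ-cong (yes _) (yes _) _   _   = refl
  χ-cong (no _)  (no _)  _   _   = refl
  χ-cong (yes p) (no ¬q) P→Q _   = contradiction (P→Q p) ¬q
  χ-cong (no ¬p) (yes q) _   Q→P = contradiction (Q→P q) ¬p

count : ∀ {ℓ} {P : Pred ℕ ℓ} → Decidable P → ℕ → ℕ
count P? n = length (filter P? (applyUpTo suc n))

module _ {ℓ} {P : Pred ℕ ℓ} (P? : Decidable P) where

  length-filter-applyUpTo-suc : ∀ f n →
    length (filter P? (applyUpTo f (suc n))) ≡ length (filter P? (applyUpTo f n)) + χ (P? (f n))
  length-filter-applyUpTo-suc f n = begin
    length (filter P? (applyUpTo f (suc n)))
      ≡⟨ cong (length ∘ filter P?) (sym (applyUpTo-∷ʳ f n)) ⟩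
    length (filter P? (applyUpTo f n ++ f n ∷ []))
      ≡⟨ cong length (filter-++ P? (applyUpTo f n) (f n ∷ [])) ⟩
    length (filter P? (applyUpTo f n) ++ filter P? (f n ∷ []))
      ≡⟨ length-++ (filter P? (applyUpTo f n)) ⟩
    length (filter P? (applyUpTo f n)) + length (filter P? (f n ∷ []))
      ≡⟨ cong (length (filter P? (applyUpTo f n)) +_) (singleton (f n)) ⟩
    length (filter P? (applyUpTo f n)) + χ (P? (f n)) ∎
    where
    open ≡-Reasoning
    singleton : ∀ x → length (filter P? (x ∷ [])) ≡ χ (P? x)
    singleton x with P? x
    ... | yes _ = refl
    ... | no _  = refl

  length-filter-applyUpTo-mono : ∀ f {m n} → m ≤ n →
    length (filter P? (applyUpTo f m)) ≤ length (filter P? (applyUpTo f n))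
  length-filter-applyUpTo-mono f m≤n = go (≤⇒≤′ m≤n)
    where
    go : ∀ {m n} → m ≤′ n → length (filter P? (applyUpTo f m)) ≤ length (filter P? (applyUpTo f n))
    go ≤′-refl         = ≤-refl
    go (≤′-step m≤′n) =
      ≤-trans (go m≤′n) (≤-trans (m≤m+n _ _) (≤-reflexive (sym (length-filter-applyUpTo-suc f _))))

  count-suc : ∀ n → count P? (suc n) ≡ count P? n + χ (P? (suc n))
  count-suc = length-filter-applyUpTo-suc suc

  count≡∑χ : ∀ n → count P? n ≡ ∑ n (χ ∘ P?)
  count≡∑χ zero    = refl
  count≡∑χ (suc n) = trans (count-suc n) (cong (_+ χ (P? (suc n))) (count≡∑χ n))

  count-≤ : ∀ n → count P? n ≤ n
  count-≤ n = ≤-trans (length-filter P? (applyUpTo suc n)) (≤-reflexive (length-applyUpTo suc n))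

  count-all : ∀ n → (∀ x → 1 ≤ x → x ≤ n → P x) → count P? n ≡ n
  count-all n all = trans (cong length (filter-all P? (AllP.applyUpTo⁺₁ suc n λ i<n → all _ (s≤s z≤n) i<n)))
                          (length-applyUpTo suc n)

count-cong : ∀ {ℓ ℓ′} {P : Pred ℕ ℓ} {Q : Pred ℕ ℓ′} (P? : Decidable P) (Q? : Decidable Q) n →
             (∀ x → 1 ≤ x → x ≤ n → P x → Q x) → (∀ x → 1 ≤ x → x ≤ n → Q x → P x) →
             count P? n ≡ count Q? n
count-cong P? Q? n P→Q Q→P = begin
  count P? n        ≡⟨ count≡∑χ P? n ⟩
  ∑ n (χ ∘ P?)      ≡⟨ ∑-cong n (λ x 1≤x x≤n → χ-cong (P? x) (Q? x) (P→Q x 1≤x x≤n) (Q→P x 1≤x x≤n)) ⟩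
  ∑ n (χ ∘ Q?)      ≡⟨ sym (count≡∑χ Q? n) ⟩
  count Q? n        ∎
  where open ≡-Reasoning

count-¬+∑χ : ∀ {ℓ} {P : Pred ℕ ℓ} (P? : Decidable P) n → count (¬? ∘ P?) n + ∑ n (χ ∘ P?) ≡ n
count-¬+∑χ P? n = begin
  count (¬? ∘ P?) n + ∑ n (χ ∘ P?)           ≡⟨ cong (_+ ∑ n (χ ∘ P?)) (count≡∑χ (¬? ∘ P?) n) ⟩
  ∑ n (χ ∘ ¬? ∘ P?) + ∑ n (χ ∘ P?)           ≡⟨ sym (∑-+ n (χ ∘ ¬? ∘ P?) (χ ∘ P?)) ⟩
  ∑ n (λ x → χ (¬? (P? x)) + χ (P? x))       ≡⟨ ∑-cong n (λ x _ _ → χ-¬ (P? x)) ⟩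
  ∑ n (λ _ → 1)                              ≡⟨ ∑-const n 1 ⟩
  n * 1                                      ≡⟨ *-identityʳ n ⟩
  n                                          ∎
  where open ≡-Reasoning

T[∑χ]≤∑[id*χ] : ∀ {ℓ} {P : Pred ℕ ℓ} (P? : Decidable P) n → T (∑ n (χ ∘ P?)) ≤ ∑ n (λ x → x * χ (P? x))
T[∑χ]≤∑[id*χ] P? zero    = z≤n
T[∑χ]≤∑[id*χ] P? (suc n) with P? (suc n)
... | no _  = begin
  T (∑ n (χ ∘ P?) + 0)                   ≡⟨ cong T (+-identityʳ (∑ n (χ ∘ P?))) ⟩
  T (∑ n (χ ∘ P?))                       ≤⟨ T[∑χ]≤∑[id*χ] P? n ⟩
  ∑ n (λ x → x * χ (P? x))               ≤⟨ m≤m+n _ _ ⟩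
  ∑ n (λ x → x * χ (P? x)) + suc n * 0   ∎
  where open ≤-Reasoning
... | yes _ = begin
  T (∑ n (χ ∘ P?) + 1)                   ≡⟨ cong T (+-comm (∑ n (χ ∘ P?)) 1) ⟩
  T (suc (∑ n (χ ∘ P?)))                 ≡⟨ T-suc (∑ n (χ ∘ P?)) ⟩
  T (∑ n (χ ∘ P?)) + suc (∑ n (χ ∘ P?))  ≤⟨ +-mono-≤ (T[∑χ]≤∑[id*χ] P? n) (s≤s ∑χ≤n) ⟩
  ∑ n (λ x → x * χ (P? x)) + suc n       ≡⟨ cong (∑ n (λ x → x * χ (P? x)) +_) (sym (*-identityʳ (suc n))) ⟩
  ∑ n (λ x → x * χ (P? x)) + suc n * 1   ∎
  where
  open ≤-Reasoning
  ∑χ≤n : ∑ n (χ ∘ P?) ≤ n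
  ∑χ≤n = subst (_≤ n) (count≡∑χ P? n) (count-≤ P? n)

T[∑χ∸1]+n≤∑[id*χ] : ∀ {ℓ} {P : Pred ℕ ℓ} (P? : Decidable P) n → P n →
                    T (∑ n (χ ∘ P?) ∸ 1) + n ≤ ∑ n (λ x → x * χ (P? x))
T[∑χ∸1]+n≤∑[id*χ] P? zero    _  = z≤n
T[∑χ∸1]+n≤∑[id*χ] P? (suc n) Pn = begin
  T (∑ n (χ ∘ P?) + χ (P? (suc n)) ∸ 1) + suc n
    ≡⟨ cong (λ c → T (∑ n (χ ∘ P?) + c ∸ 1) + suc n) χ≡1 ⟩
  T (∑ n (χ ∘ P?) + 1 ∸ 1) + suc n
    ≡⟨ cong (λ s → T s + suc n) (m+n∸n≡m (∑ n (χ ∘ P?)) 1) ⟩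
  T (∑ n (χ ∘ P?)) + suc n
    ≤⟨ +-monoˡ-≤ (suc n) (T[∑χ]≤∑[id*χ] P? n) ⟩
  ∑ n (λ x → x * χ (P? x)) + suc n
    ≡⟨ cong (∑ n (λ x → x * χ (P? x)) +_) (sym (*-identityʳ (suc n))) ⟩
  ∑ n (λ x → x * χ (P? x)) + suc n * 1
    ≡⟨ cong (λ c → ∑ n (λ x → x * χ (P? x)) + suc n * c) (sym χ≡1) ⟩
  ∑ n (λ x → x * χ (P? x)) + suc n * χ (P? (suc n)) ∎
  where
  open ≤-Reasoning
  χ≡1 = χ-yes (P? (suc n)) Pn

-- Distinct partitions as indicator functions

𝟙 : List ℕ → ℕ → ℕ
𝟙 λs x = χ (x ∈? λs)

∈⇒≤largest : ∀ {x} xs → x ∈ xs → x ≤ largest xs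
∈⇒≤largest (y ∷ ys) (here refl) = m≤m⊔n y (largest ys)
∈⇒≤largest (y ∷ ys) (there x∈) = ≤-trans (∈⇒≤largest ys x∈) (m≤n⊔m y (largest ys))

largest∈ : ∀ x xs → largest (x ∷ xs) ∈ x ∷ xs
largest∈ x []       = here (⊔-identityʳ x)
largest∈ x (y ∷ ys) with ⊔-sel x (largest (y ∷ ys))
... | inj₁ x⊔l≡x = here x⊔l≡x
... | inj₂ x⊔l≡l = there (subst (_∈ y ∷ ys) (sym x⊔l≡l) (largest∈ y ys))

∑[f*χ≟]≡f : ∀ (f : ℕ → ℕ) {y} B → 1 ≤ y → y ≤ B → ∑ B (λ x → f x * χ (x ≟ y)) ≡ f y
∑[f*χ≟]≡f f zero    1≤y y≤0 = contradiction (≤-trans 1≤y y≤0) λ ()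
∑[f*χ≟]≡f f {y} (suc B) 1≤y y≤1+B with m≤n⇒m<n∨m≡n y≤1+B
... | inj₁ y≤B  = begin
  ∑ B (λ x → f x * χ (x ≟ y)) + f (suc B) * χ (suc B ≟ y)
    ≡⟨ cong₂ _+_ (∑[f*χ≟]≡f f B 1≤y (≤-pred y≤B)) (cong (f (suc B) *_) (χ-no (suc B ≟ y) (>⇒≢ y≤B))) ⟩
  f y + f (suc B) * 0
    ≡⟨ cong (f y +_) (*-zeroʳ (f (suc B))) ⟩
  f y + 0
    ≡⟨ +-identityʳ (f y) ⟩
  f y ∎
  where open ≡-Reasoning
... | inj₂ refl = begin
  ∑ B (λ x → f x * χ (x ≟ suc B)) + f (suc B) * χ (suc B ≟ suc B)
    ≡⟨ cong₂ _+_ below (cong (f (suc B) *_) (χ-yes (suc B ≟ suc B) refl)) ⟩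
  0 + f (suc B) * 1
    ≡⟨ *-identityʳ (f (suc B)) ⟩
  f (suc B) ∎
  where
  open ≡-Reasoning
  below : ∑ B (λ x → f x * χ (x ≟ suc B)) ≡ 0
  below = trans (∑-cong B (λ x _ x≤B → trans (cong (f x *_) (χ-no (x ≟ suc B) (<⇒≢ (s≤s x≤B)))) (*-zeroʳ (f x))))
                (trans (∑-const B 0) (*-zeroʳ B))

𝟙-∷ : ∀ {y ys} → y ∉ ys → ∀ x → 𝟙 (y ∷ ys) x ≡ χ (x ≟ y) + 𝟙 ys x
𝟙-∷ {y} {ys} y∉ys x = by-cases (x ≟ y) (x ∈? ys)
  where
  by-cases : Dec (x ≡ y) → Dec (x ∈ ys) → 𝟙 (y ∷ ys) x ≡ χ (x ≟ y) + 𝟙 ys x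
  by-cases (yes refl) _ =
    trans (χ-yes (x ∈? y ∷ ys) (here refl)) (sym (cong₂ _+_ (χ-yes (x ≟ y) refl) (χ-no (x ∈? ys) y∉ys)))
  by-cases (no x≢y) (yes x∈ys) =
    trans (χ-yes (x ∈? y ∷ ys) (there x∈ys)) (sym (cong₂ _+_ (χ-no (x ≟ y) x≢y) (χ-yes (x ∈? ys) x∈ys)))
  by-cases (no x≢y) (no x∉ys) =
    trans (χ-no (x ∈? y ∷ ys) λ { (here x≡y) → x≢y x≡y ; (there x∈ys) → x∉ys x∈ys })
          (sym (cong₂ _+_ (χ-no (x ≟ y) x≢y) (χ-no (x ∈? ys) x∉ys)))

∑[id*𝟙]≡sum : ∀ {B} λs → Linked _<_ λs → All (1 ≤_) λs → All (_≤ B) λs → ∑ B (λ x → x * 𝟙 λs x) ≡ sum λs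
∑[id*𝟙]≡sum {B} []       _   _            _          =
  trans (∑-cong B (λ x _ _ → *-zeroʳ x)) (trans (∑-const B 0) (*-zeroʳ B))
∑[id*𝟙]≡sum {B} (y ∷ ys) inc (1≤y ∷ pos) (y≤B ∷ bnd) = begin
  ∑ B (λ x → x * 𝟙 (y ∷ ys) x)
    ≡⟨ ∑-cong B (λ x _ _ → cong (x *_) (𝟙-∷ y∉ys x)) ⟩
  ∑ B (λ x → x * (χ (x ≟ y) + 𝟙 ys x))
    ≡⟨ ∑-cong B (λ x _ _ → *-distribˡ-+ x (χ (x ≟ y)) (𝟙 ys x)) ⟩
  ∑ B (λ x → x * χ (x ≟ y) + x * 𝟙 ys x)
    ≡⟨ ∑-+ B (λ x → x * χ (x ≟ y)) (λ x → x * 𝟙 ys x) ⟩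
  ∑ B (λ x → x * χ (x ≟ y)) + ∑ B (λ x → x * 𝟙 ys x)
    ≡⟨ cong₂ _+_ (∑[f*χ≟]≡f (λ x → x) B 1≤y y≤B) (∑[id*𝟙]≡sum ys (Linked.tail inc) pos bnd) ⟩
  y + sum ys ∎
  where
  open ≡-Reasoning
  y∉ys : y ∉ ys
  y∉ys y∈ys = <-irrefl refl (All.lookup (y<ys inc) y∈ys)
    where
    y<ys : ∀ {y ys} → Linked _<_ (y ∷ ys) → All (y <_) ys
    y<ys [-]        = []
    y<ys (y<z ∷ zs) = LinkedP.Linked⇒All <-trans y<z zs

unrefinable-pair : ∀ {λs g a} → Unrefinable λs → g ∈ λs → 1 ≤ a → a + a < g → 1 ≤ 𝟙 λs a + 𝟙 λs (g ∸ a)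
unrefinable-pair {λs} {g} {a} unref g∈λs 1≤a 2a<g with a ∈? λs | (g ∸ a) ∈? λs
... | yes _   | _       = s≤s z≤n
... | no _    | yes _   = s≤s z≤n
... | no a∉λs | no b∉λs =
  contradiction (a , g ∸ a , <⇒≢ a<b , (1≤a , a≤L , a∉λs) , (≤-trans (s≤s z≤n) a<b , b≤L , b∉λs) , a+b∈λs) unref
  where
  a≤g : a ≤ g
  a≤g = ≤-trans (m≤m+n a a) (<⇒≤ 2a<g)
  a<b : a < g ∸ a
  a<b = +-cancelˡ-< a a (g ∸ a) (≤-trans 2a<g (≤-reflexive (sym (m+[n∸m]≡n a≤g))))
  a≤L : a ≤ largest λs
  a≤L = ≤-trans a≤g (∈⇒≤largest λs g∈λs)
  b≤L : g ∸ a ≤ largest λs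
  b≤L = ≤-trans (m∸n≤m g a) (∈⇒≤largest λs g∈λs)
  a+b∈λs : a + (g ∸ a) ∈ λs
  a+b∈λs = subst (_∈ λs) (sym (m+[n∸m]≡n a≤g)) g∈λs

module _ {N λs} (dp : IsDistinctPartition N λs) where
  open IsDistinctPartition dp

  largest∈λs : largest λs ∈ λs
  largest∈λs = nonEmpty atLeastTwo
    where
    nonEmpty : ∀ {xs} → 2 ≤ length xs → largest xs ∈ xs
    nonEmpty {x ∷ xs} _ = largest∈ x xs

  ∑[id*𝟙]≡N : ∑ (largest λs) (λ x → x * 𝟙 λs x) ≡ N
  ∑[id*𝟙]≡N = trans (∑[id*𝟙]≡sum λs increasing positive (All.tabulate (∈⇒≤largest λs))) sumIs

  T[parts∸1]+largest≤N : T (∑ (largest λs) (𝟙 λs) ∸ 1) + largest λs ≤ N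
  T[parts∸1]+largest≤N = ≤-trans (T[∑χ∸1]+n≤∑[id*χ] (_∈? λs) (largest λs) largest∈λs) (≤-reflexive ∑[id*𝟙]≡N)

parts≡⌈largest/2⌉ : ∀ λs → length (missingList λs) ≡ ⌊ largest λs /2⌋ → ∑ (largest λs) (𝟙 λs) ≡ ⌈ largest λs /2⌉
parts≡⌈largest/2⌉ λs missing≡ = +-cancelˡ-≡ ⌊ largest λs /2⌋ _ _ (begin
  ⌊ largest λs /2⌋ + ∑ (largest λs) (𝟙 λs)           ≡⟨ cong (_+ ∑ (largest λs) (𝟙 λs)) (sym missing≡) ⟩
  length (missingList λs) + ∑ (largest λs) (𝟙 λs)    ≡⟨ count-¬+∑χ (_∈? λs) (largest λs) ⟩
  largest λs                                         ≡⟨ sym (⌊n/2⌋+⌈n/2⌉≡n (largest λs)) ⟩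
  ⌊ largest λs /2⌋ + ⌈ largest λs /2⌉                ∎)
  where open ≡-Reasoning

-- The largest part of a partition in Ū_{T (p + 2)}

s+s∸a≡a+2[s∸a] : ∀ {a s} → a ≤ s → s + s ∸ a ≡ a + 2 * (s ∸ a)
s+s∸a≡a+2[s∸a] {a} {s} a≤s = begin
  s + s ∸ a                ≡⟨ +-∸-comm s a≤s ⟩
  s ∸ a + s                ≡⟨ cong (s ∸ a +_) (sym (m+[n∸m]≡n a≤s)) ⟩
  s ∸ a + (a + (s ∸ a))    ≡⟨ regroup (s ∸ a) a ⟩
  a + 2 * (s ∸ a)          ∎
  where
  open ≡-Reasoning
  regroup : ∀ d a → d + (a + d) ≡ a + 2 * d
  regroup = solve-∀

pair-contribution : ∀ a d ca cb → ca + cb ≡ 1 → a * ca + (a + 2 * d) * cb ≡ a + 2 * (d * cb)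
pair-contribution a d ca cb ca+cb≡1 = begin
  a * ca + (a + 2 * d) * cb    ≡⟨ regroup a d ca cb ⟩
  a * (ca + cb) + 2 * (d * cb) ≡⟨ cong (λ c → a * c + 2 * (d * cb)) ca+cb≡1 ⟩
  a * 1 + 2 * (d * cb)         ≡⟨ cong (_+ 2 * (d * cb)) (*-identityʳ a) ⟩
  a + 2 * (d * cb)             ∎
  where
  open ≡-Reasoning
  regroup : ∀ a d ca cb → a * ca + (a + 2 * d) * cb ≡ a * (ca + cb) + 2 * (d * cb)
  regroup = solve-∀

module _ {ℓ} {P : Pred ℕ ℓ} (P? : Decidable P) p (P[2+p+p] : P (2 + (p + p)))
         (pairs : ∀ a → 1 ≤ a → a ≤ p → 1 ≤ χ (P? a) + χ (P? (2 + (p + p) ∸ a)))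
         (∑χ≡1+p : ∑ (2 + (p + p)) (χ ∘ P?) ≡ suc p) where

  private
    L = 2 + (p + p)
    c : ℕ → ℕ
    c = χ ∘ P?

  pairs-exact : c (suc p) ≡ 0 × (∀ a → 1 ≤ a → a ≤ p → c a + c (L ∸ a) ≡ 1)
  pairs-exact = ∑-tight p (λ a → c a + c (L ∸ a)) (c (suc p)) pairs (suc-injective (begin
    suc (∑ p (λ a → c a + c (L ∸ a)) + c (suc p))
      ≡⟨ +-comm 1 _ ⟩
    ∑ p (λ a → c a + c (L ∸ a)) + c (suc p) + 1
      ≡⟨ cong₂ _+_ (sym (∑-reflect p c)) (sym (χ-yes (P? L) P[2+p+p])) ⟩
    ∑ L c
      ≡⟨ ∑χ≡1+p ⟩
    suc p ∎))
    where open ≡-Reasoning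

  ∑[id*χ]-reflected : ∃[ Y ] ∑ L (λ x → x * c x) ≡ T p + 2 * Y + L
  ∑[id*χ]-reflected = ∑ p y , (begin
    ∑ L (λ x → x * c x)
      ≡⟨ cong (_+ L * c L) (∑-reflect p (λ x → x * c x)) ⟩
    ∑ p (λ a → a * c a + (L ∸ a) * c (L ∸ a)) + suc p * c (suc p) + L * c L
      ≡⟨ cong₂ (λ s t → s + suc p * t + L * c L) (∑-cong p pair≡) (proj₁ pairs-exact) ⟩
    ∑ p (λ a → a + 2 * y a) + suc p * 0 + L * c L
      ≡⟨ cong₂ (λ s t → s + t + L * c L) (∑-+ p (λ a → a) (λ a → 2 * y a)) (*-zeroʳ (suc p)) ⟩
    ∑ p (λ a → a) + ∑ p (λ a → 2 * y a) + 0 + L * c L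
      ≡⟨ cong₂ (λ s t → s + t + 0 + L * c L) (∑-id p) (∑-*ˡ p 2 y) ⟩
    T p + 2 * ∑ p y + 0 + L * c L
      ≡⟨ cong₂ _+_ (+-identityʳ (T p + 2 * ∑ p y)) (cong (L *_) (χ-yes (P? L) P[2+p+p])) ⟩
    T p + 2 * ∑ p y + L * 1
      ≡⟨ cong (T p + 2 * ∑ p y +_) (*-identityʳ L) ⟩
    T p + 2 * ∑ p y + L ∎)
    where
    open ≡-Reasoning
    y : ℕ → ℕ
    y a = (suc p ∸ a) * c (L ∸ a)
    pair≡ : ∀ a → 1 ≤ a → a ≤ p → a * c a + (L ∸ a) * c (L ∸ a) ≡ a + 2 * y a
    pair≡ a 1≤a a≤p = begin
      a * c a + (L ∸ a) * c (L ∸ a)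
        ≡⟨ cong (λ b → a * c a + (b ∸ a) * c (L ∸ a)) (sym (+-suc (suc p) p)) ⟩
      a * c a + (suc p + suc p ∸ a) * c (L ∸ a)
        ≡⟨ cong (λ b → a * c a + b * c (L ∸ a)) (s+s∸a≡a+2[s∸a] (m≤n⇒m≤1+n a≤p)) ⟩
      a * c a + (a + 2 * (suc p ∸ a)) * c (L ∸ a)
        ≡⟨ pair-contribution a (suc p ∸ a) (c a) (c (L ∸ a)) (proj₂ pairs-exact a 1≤a a≤p) ⟩
      a + 2 * y a ∎

T[2+p]≢T[p]+2Y+2+p+p : ∀ p Y → T (2 + p) ≢ T p + 2 * Y + (2 + (p + p))
T[2+p]≢T[p]+2Y+2+p+p p Y eq = contradiction (m*n≡1⇒m≡1 2 Y (sym 1≡2Y)) λ ()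
  where
  open ≡-Reasoning
  regroup : ∀ t p → t + suc p + (2 + p) ≡ t + 1 + (2 + (p + p))
  regroup = solve-∀
  1≡2Y : 1 ≡ 2 * Y
  1≡2Y = +-cancelˡ-≡ (T p) _ _ (+-cancelʳ-≡ (2 + (p + p)) _ _ (begin
    T p + 1 + (2 + (p + p))      ≡⟨ sym (regroup (T p) p) ⟩
    T p + suc p + (2 + p)        ≡⟨ cong (_+ (2 + p)) (sym (T-suc p)) ⟩
    T (1 + p) + (2 + p)          ≡⟨ sym (T-suc (1 + p)) ⟩
    T (2 + p)                    ≡⟨ eq ⟩
    T p + 2 * Y + (2 + (p + p))  ∎))

module _ {p λs} (dp : IsDistinctPartition (T (2 + p)) λs)
         (missing≡ : length (missingList λs) ≡ ⌊ largest λs /2⌋) where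

  largest≱3+p+p : ¬ (3 + (p + p) ≤ largest λs)
  largest≱3+p+p 3+p+p≤L = <⇒≱ (s≤s (s≤s (s≤s (m≤m+n p p)))) (+-cancelˡ-≤ (T (1 + p)) _ _ (begin
    T (1 + p) + (3 + (p + p))                  ≤⟨ +-mono-≤ (T-mono-≤ (∸-monoˡ-≤ 1 parts≥2+p)) 3+p+p≤L ⟩
    T (∑ (largest λs) (𝟙 λs) ∸ 1) + largest λs ≤⟨ T[parts∸1]+largest≤N dp ⟩
    T (2 + p)                                  ≡⟨ T-suc (1 + p) ⟩
    T (1 + p) + (2 + p)                        ∎))
    where
    open ≤-Reasoning
    parts≥2+p : 2 + p ≤ ∑ (largest λs) (𝟙 λs)
    parts≥2+p = begin
      2 + p                    ≡⟨ cong (2 +_) (n≡⌊n+n/2⌋ p) ⟩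
      ⌈ 3 + (p + p) /2⌉        ≤⟨ ⌈n/2⌉-mono 3+p+p≤L ⟩
      ⌈ largest λs /2⌉         ≡⟨ sym (parts≡⌈largest/2⌉ λs missing≡) ⟩
      ∑ (largest λs) (𝟙 λs)    ∎

  largest≢2+p+p : Unrefinable λs → largest λs ≢ 2 + (p + p)
  largest≢2+p+p unref L≡ = T[2+p]≢T[p]+2Y+2+p+p p (proj₁ reflected) (begin
    T (2 + p)                                   ≡⟨ sym (∑[id*𝟙]≡N dp) ⟩
    ∑ (largest λs) (λ x → x * 𝟙 λs x)           ≡⟨ cong (λ M → ∑ M (λ x → x * 𝟙 λs x)) L≡ ⟩
    ∑ L (λ x → x * 𝟙 λs x)                      ≡⟨ proj₂ reflected ⟩
    T p + 2 * proj₁ reflected + L               ∎)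
    where
    open ≡-Reasoning
    L = 2 + (p + p)
    L∈λs : L ∈ λs
    L∈λs = subst (_∈ λs) L≡ (largest∈λs dp)
    parts≡1+p : ∑ L (𝟙 λs) ≡ suc p
    parts≡1+p = begin
      ∑ L (𝟙 λs)              ≡⟨ cong (λ M → ∑ M (𝟙 λs)) (sym L≡) ⟩
      ∑ (largest λs) (𝟙 λs)   ≡⟨ parts≡⌈largest/2⌉ λs missing≡ ⟩
      ⌈ largest λs /2⌉        ≡⟨ cong ⌈_/2⌉ L≡ ⟩
      suc ⌈ p + p /2⌉         ≡⟨ cong suc (sym (n≡⌈n+n/2⌉ p)) ⟩
      suc p                   ∎
    pairs : ∀ a → 1 ≤ a → a ≤ p → 1 ≤ 𝟙 λs a + 𝟙 λs (L ∸ a)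
    pairs a 1≤a a≤p = unrefinable-pair unref L∈λs 1≤a (s≤s (m≤n⇒m≤1+n (+-mono-≤ a≤p a≤p)))
    reflected = ∑[id*χ]-reflected (_∈? λs) p L∈λs pairs parts≡1+p

  largest≤1+p+p : Unrefinable λs → largest λs ≤ suc (p + p)
  largest≤1+p+p unref with largest λs ≤? suc (p + p)
  ... | yes L≤1+p+p = L≤1+p+p
  ... | no  L≰1+p+p with m≤n⇒m<n∨m≡n (≰⇒> L≰1+p+p)
  ...   | inj₁ 3+p+p≤L = contradiction 3+p+p≤L largest≱3+p+p
  ...   | inj₂ 2+p+p≡L = contradiction (sym 2+p+p≡L) (largest≢2+p+p unref)

sum-applyUpTo-suc : ∀ n → sum (applyUpTo suc n) ≡ T n
sum-applyUpTo-suc zero    = refl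
sum-applyUpTo-suc (suc n) = begin
  sum (applyUpTo suc (suc n))            ≡⟨ cong sum (sym (applyUpTo-∷ʳ suc n)) ⟩
  sum (applyUpTo suc n ++ suc n ∷ [])    ≡⟨ sum-++ (applyUpTo suc n) (suc n ∷ []) ⟩
  sum (applyUpTo suc n) + (suc n + 0)    ≡⟨ cong₂ _+_ (sum-applyUpTo-suc n) (+-identityʳ (suc n)) ⟩
  T n + suc n                            ≡⟨ sym (T-suc n) ⟩
  T (suc n)                              ∎
  where open ≡-Reasoning

Linked-++-∷⁺ : ∀ {xs y ys} → Linked _<_ xs → All (_< y) xs → Linked _<_ (y ∷ ys) → Linked _<_ (xs ++ y ∷ ys)
Linked-++-∷⁺ []         []           y∷ys = y∷ys
Linked-++-∷⁺ [-]        (x<y ∷ [])   y∷ys = x<y ∷ y∷ys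
Linked-++-∷⁺ (x<x′ ∷ xs) (_ ∷ xs<y) y∷ys = x<x′ ∷ Linked-++-∷⁺ xs xs<y y∷ys

distinct-sum-≥ : ∀ {m a b} → m ≤ a → m ≤ b → a ≢ b → suc (m + m) ≤ a + b
distinct-sum-≥ {m} {a} {b} m≤a m≤b a≢b with <-cmp a b
... | tri< a<b _ _ = ≤-trans (≤-reflexive (sym (+-suc m m))) (+-mono-≤ m≤a (≤-trans (s≤s m≤a) a<b))
... | tri≈ _ a≡b _ = contradiction a≡b a≢b
... | tri> _ _ b<a = +-mono-≤ (≤-trans (s≤s m≤b) b<a) m≤b

unrefinableWitness : ℕ → List ℕ
unrefinableWitness p = applyUpTo suc (p ∸ 1) ++ 3 + p ∷ p + p ∷ []

module _ {p} (4≤p : 4 ≤ p) where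

  private
    μ = unrefinableWitness p
    r = p ∸ 1
    1≤p : 1 ≤ p
    1≤p = ≤-trans (s≤s z≤n) 4≤p
    p≡1+r : p ≡ suc r
    p≡1+r = sym (m+[n∸m]≡n 1≤p)

  unrefinableWitness-partition : IsDistinctPartition (T (2 + p)) μ
  unrefinableWitness-partition = record
    { increasing = Linked-++-∷⁺ (LinkedP.applyUpTo⁺₂ suc r (λ i → n<1+n (suc i)))
                                (AllP.applyUpTo⁺₁ suc r (λ i<r → s≤s (≤-trans i<r (≤-trans (m∸n≤m p 1) (m≤n+m p 2)))))
                                (+-monoˡ-≤ p 4≤p ∷ [-])
    ; positive   = AllP.++⁺ (AllP.applyUpTo⁺₁ suc r (λ _ → s≤s z≤n)) (s≤s z≤n ∷ ≤-trans 1≤p (m≤m+n p p) ∷ [])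
    ; atLeastTwo = ≤-trans (m≤n+m 2 _) (≤-reflexive (sym (length-++ (applyUpTo suc r))))
    ; sumIs      = begin
        sum μ
          ≡⟨ sum-++ (applyUpTo suc r) (3 + p ∷ p + p ∷ []) ⟩
        sum (applyUpTo suc r) + (3 + p + (p + p + 0))
          ≡⟨ cong (_+ (3 + p + (p + p + 0))) (sum-applyUpTo-suc r) ⟩
        T r + (3 + p + (p + p + 0))
          ≡⟨ cong (λ q → T r + (3 + q + (q + q + 0))) p≡1+r ⟩
        T r + (4 + r + (suc r + suc r + 0))
          ≡⟨ regroup (T r) r ⟩
        T r + suc r + (2 + r) + (3 + r)
          ≡⟨ cong (λ t → t + (2 + r) + (3 + r)) (sym (T-suc r)) ⟩
        T (1 + r) + (2 + r) + (3 + r)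
          ≡⟨ cong (_+ (3 + r)) (sym (T-suc (1 + r))) ⟩
        T (2 + r) + (3 + r)
          ≡⟨ sym (T-suc (2 + r)) ⟩
        T (3 + r)
          ≡⟨ cong (λ q → T (2 + q)) (sym p≡1+r) ⟩
        T (2 + p) ∎
    }
    where
    open ≡-Reasoning
    regroup : ∀ t r → t + (4 + r + (suc r + suc r + 0)) ≡ t + suc r + (2 + r) + (3 + r)
    regroup = solve-∀

  unrefinableWitness-unrefinable : Unrefinable μ
  unrefinableWitness-unrefinable (a , b , a≢b , (1≤a , _ , a∉μ) , (1≤b , _ , b∉μ) , a+b∈μ) =
    <⇒≱ (distinct-sum-≥ (missing≥p 1≤a a∉μ) (missing≥p 1≤b b∉μ) a≢b) (All.lookup μ≤p+p a+b∈μ)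
    where
    μ≤p+p : All (_≤ p + p) μ
    μ≤p+p = AllP.++⁺ (AllP.applyUpTo⁺₁ suc r (λ i<r → ≤-trans i<r (≤-trans (m∸n≤m p 1) (m≤m+n p p))))
                     (+-monoˡ-≤ p (≤-trans (n≤1+n 3) 4≤p) ∷ ≤-refl ∷ [])
    missing≥p : ∀ {x} → 1 ≤ x → x ∉ μ → p ≤ x
    missing≥p {suc i} _ x∉μ with p ≤? suc i
    ... | yes p≤x = p≤x
    ... | no  p≰x = contradiction (∈-++⁺ˡ (∈-applyUpTo⁺ suc (∸-monoˡ-≤ 1 (≰⇒> p≰x)))) x∉μ

  p+p≤largest : ∀ {λs} → IsMaximalUnrefinable (T (2 + p)) λs → p + p ≤ largest λs
  p+p≤largest (_ , maximal) =
    ≤-trans (∈⇒≤largest μ (∈-++⁺ʳ (applyUpTo suc r) (there (here refl))))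
            (maximal μ (unrefinableWitness-partition , unrefinableWitness-unrefinable))

⌊largest/2⌋≡p : ∀ {p λs} → 4 ≤ p → InUbar (T (2 + p)) λs → ⌊ largest λs /2⌋ ≡ p
⌊largest/2⌋≡p {p} {λs} 4≤p (maximal@((dp , unref) , _) , missing≡) = ≤-antisym
  (begin
    ⌊ largest λs /2⌋     ≤⟨ ⌊n/2⌋-mono (largest≤1+p+p dp missing≡ unref) ⟩
    ⌈ p + p /2⌉          ≡⟨ sym (n≡⌈n+n/2⌉ p) ⟩
    p                    ∎)
  (begin
    p                    ≡⟨ n≡⌊n+n/2⌋ p ⟩
    ⌊ p + p /2⌋          ≤⟨ ⌊n/2⌋-mono (p+p≤largest 4≤p maximal) ⟩
    ⌊ largest λs /2⌋     ∎)
  where open ≤-Reasoning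

-- Young diagrams

module _ {a ℓ} {A : Set a} {R : Rel A ℓ} where

  private
    reverseAcc⁺ : ∀ {x acc xs} → Linked (flip R) (x ∷ acc) → Linked R (x ∷ xs) →
                  Linked (flip R) (reverseAcc (x ∷ acc) xs)
    reverseAcc⁺ R⁻¹acc [-]          = R⁻¹acc
    reverseAcc⁺ R⁻¹acc (Rxy ∷ Rxs) = reverseAcc⁺ (Rxy ∷ R⁻¹acc) Rxs

  Linked-reverse⁺ : ∀ {xs} → Linked R xs → Linked (flip R) (reverse xs)
  Linked-reverse⁺ {[]}    _   = []
  Linked-reverse⁺ {_ ∷ _} Rxs = reverseAcc⁺ [-] Rxs

reverse≡largest∷ : ∀ {x xs} → Linked _<_ (x ∷ xs) → ∃[ rest ] reverse (x ∷ xs) ≡ largest (x ∷ xs) ∷ rest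
reverse≡largest∷ = go
  where
  go : ∀ {x acc xs} → Linked _<_ (x ∷ xs) → ∃[ rest ] reverseAcc (x ∷ acc) xs ≡ largest (x ∷ xs) ∷ rest
  go {x} {acc} [-] = acc , cong (_∷ acc) (sym (⊔-identityʳ x))
  go {x} {acc} {y ∷ ys} (x<y ∷ inc) with go {y} {x ∷ acc} inc
  ... | rest , eq = rest , trans eq (cong (_∷ rest) (sym (m≤n⇒m⊔n≡n x≤l)))
    where
    x≤l : x ≤ largest (y ∷ ys)
    x≤l = ≤-trans (<⇒≤ x<y) (m≤m⊔n y (largest ys))

nth-antitone : ∀ {xs} → Linked _≥_ xs → ∀ i → nth xs (suc i) ≤ nth xs i
nth-antitone []         _       = z≤n
nth-antitone [-]        _       = z≤n
nth-antitone (x≥y ∷ _)  zero    = x≥y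
nth-antitone (_ ∷ ≥ys)  (suc i) = nth-antitone ≥ys i

rowLen-antitone : ∀ {λs} → Linked _<_ λs → ∀ i → rowLen λs (suc (suc i)) ≤ rowLen λs (suc i)
rowLen-antitone {λs} inc = nth-antitone (LinkedP.map⁺ (Linked.map rowOfPart-mono (Linked-reverse⁺ inc)))
  where
  rowOfPart-mono : ∀ {g h} → h < g → rowOfPart λs h ≤ rowOfPart λs g
  rowOfPart-mono h<g = length-filter-applyUpTo-mono (¬? ∘ (_∈? λs)) (λ x → x) (<⇒≤ h<g)

-- The extra cell is the one for 0 ∈ S_λ.
rowOfPart≡1+missingBelow : ∀ {λs g} → All (1 ≤_) λs → g ∈ λs → rowOfPart λs g ≡ suc (count (¬? ∘ (_∈? λs)) g)
rowOfPart≡1+missingBelow {g = zero}  pos 0∈λs = contradiction (All.lookup pos 0∈λs) λ ()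
rowOfPart≡1+missingBelow {λs} {suc g} pos g∈λs = begin
  length (filter notPart? (0 ∷ applyUpTo suc g))
    ≡⟨ cong length (filter-accept notPart? (λ 0∈λs → contradiction (All.lookup pos 0∈λs) λ ())) ⟩
  suc (count notPart? g)
    ≡⟨ cong suc (sym (+-identityʳ _)) ⟩
  suc (count notPart? g + 0)
    ≡⟨ cong (λ c → suc (count notPart? g + c)) (sym (χ-no (notPart? (suc g)) λ g∉λs → g∉λs g∈λs)) ⟩
  suc (count notPart? g + χ (notPart? (suc g)))
    ≡⟨ cong suc (sym (count-suc notPart? g)) ⟩
  suc (count notPart? (suc g)) ∎
  where
  open ≡-Reasoning
  notPart? = ¬? ∘ (_∈? λs)

rowLen[1]≡1+missing : ∀ {N λs} → IsDistinctPartition N λs → rowLen λs 1 ≡ suc (length (missingList λs))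
rowLen[1]≡1+missing {λs = []}     dp = contradiction (IsDistinctPartition.atLeastTwo dp) λ ()
rowLen[1]≡1+missing {λs = x ∷ xs} dp with reverse≡largest∷ (IsDistinctPartition.increasing dp)
... | rest , rev≡ = begin
  nth (map (rowOfPart (x ∷ xs)) (reverse (x ∷ xs))) 0
    ≡⟨ cong (λ ys → nth (map (rowOfPart (x ∷ xs)) ys) 0) rev≡ ⟩
  rowOfPart (x ∷ xs) (largest (x ∷ xs))
    ≡⟨ rowOfPart≡1+missingBelow (IsDistinctPartition.positive dp) (largest∈ x xs) ⟩
  suc (length (missingList (x ∷ xs))) ∎
  where open ≡-Reasoning

colLen≡1+leg : ∀ {λs j} → 1 ≤ numRows λs → j ≤ rowLen λs 1 → colLen λs j ≡ suc (leg λs 1 j)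
colLen≡1+leg {λs} {j} = split-first-row (numRows λs)
  where
  Q? = λ i → j ≤? rowLen λs i
  split-first-row : ∀ t → 1 ≤ t → j ≤ rowLen λs 1 →
    length (filter Q? (applyUpTo suc t)) ≡ suc (length (filter (2 ≤?_) (filter Q? (applyUpTo suc t))))
  split-first-row (suc t) _ j≤row₁ = begin
    length (filter Q? (1 ∷ rest))
      ≡⟨ cong length (filter-accept Q? j≤row₁) ⟩
    suc (length (filter Q? rest))
      ≡⟨ cong (suc ∘ length) (sym (filter-all (2 ≤?_) rest≥2)) ⟩
    suc (length (filter (2 ≤?_) (filter Q? rest)))
      ≡⟨ cong (suc ∘ length) (sym (filter-reject (2 ≤?_) {1} {filter Q? rest} λ { (s≤s ()) })) ⟩
    suc (length (filter (2 ≤?_) (1 ∷ filter Q? rest)))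
      ≡⟨ cong (suc ∘ length ∘ filter (2 ≤?_)) (sym (filter-accept Q? j≤row₁)) ⟩
    suc (length (filter (2 ≤?_) (filter Q? (1 ∷ rest)))) ∎
    where
    open ≡-Reasoning
    rest = applyUpTo (suc ∘ suc) t
    rest≥2 : All (2 ≤_) (filter Q? rest)
    rest≥2 = AllP.filter⁺ Q? (AllP.applyUpTo⁺₂ (suc ∘ suc) t λ _ → s≤s (s≤s z≤n))

hook[1,j]≡arm+colLen : ∀ {λs j} → 1 ≤ numRows λs → j ≤ rowLen λs 1 → hook λs 1 j ≡ arm λs 1 j + colLen λs j
hook[1,j]≡arm+colLen {λs} {j} 1≤t j≤row₁ = begin
  arm λs 1 j + leg λs 1 j + 1      ≡⟨ +-assoc (arm λs 1 j) (leg λs 1 j) 1 ⟩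
  arm λs 1 j + (leg λs 1 j + 1)    ≡⟨ cong (arm λs 1 j +_) (+-comm (leg λs 1 j) 1) ⟩
  arm λs 1 j + suc (leg λs 1 j)    ≡⟨ cong (arm λs 1 j +_) (sym (colLen≡1+leg {λs} 1≤t j≤row₁)) ⟩
  arm λs 1 j + colLen λs j         ∎
  where open ≡-Reasoning

module _ {ℓ} {Q : Pred ℕ ℓ} (Q? : Decidable Q) (downward : ∀ i → 1 ≤ i → Q (suc i) → Q i) where

  downward-closed : ∀ {m i} → Q m → 1 ≤ i → i ≤ m → Q i
  downward-closed {zero}  _  1≤i i≤0   = contradiction (≤-trans 1≤i i≤0) λ ()
  downward-closed {suc m} Qm 1≤i i≤1+m with m≤n⇒m<n∨m≡n i≤1+m
  ... | inj₁ i≤m  = downward-closed (downward m (≤-trans 1≤i (≤-pred i≤m)) Qm) 1≤i (≤-pred i≤m)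
  ... | inj₂ refl = Qm

  count-threshold : ∀ t {z} → count Q? t ≡ z → ∀ i → 1 ≤ i → i ≤ t → (Q i → i ≤ z) × (i ≤ z → Q i)
  count-threshold zero     _      i 1≤i i≤0   = contradiction (≤-trans 1≤i i≤0) λ ()
  count-threshold (suc t) {z} count≡z i 1≤i i≤1+t with Q? (suc t)
  ... | yes Q[1+t] = (λ _ → subst (i ≤_) 1+t≡z i≤1+t) , (λ _ → downward-closed Q[1+t] 1≤i i≤1+t)
    where
    1+t≡z = trans (sym (count-all Q? (suc t) λ x 1≤x x≤1+t → downward-closed Q[1+t] 1≤x x≤1+t)) count≡z
  ... | no ¬Q[1+t] = by-position (m≤n⇒m<n∨m≡n i≤1+t)
    where
    count[t]≡z : count Q? t ≡ z
    count[t]≡z = begin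
      count Q? t                        ≡⟨ sym (+-identityʳ (count Q? t)) ⟩
      count Q? t + 0                    ≡⟨ cong (count Q? t +_) (sym (χ-no (Q? (suc t)) ¬Q[1+t])) ⟩
      count Q? t + χ (Q? (suc t))       ≡⟨ sym (count-suc Q? t) ⟩
      count Q? (suc t)                  ≡⟨ count≡z ⟩
      z                                 ∎
      where open ≡-Reasoning
    z≤t = subst (_≤ t) count[t]≡z (count-≤ Q? t)
    by-position : i < suc t ⊎ i ≡ suc t → (Q i → i ≤ z) × (i ≤ z → Q i)
    by-position (inj₁ i≤t)   = count-threshold t count[t]≡z i 1≤i (≤-pred i≤t)
    by-position (inj₂ i≡1+t) = (λ Qi → contradiction (subst Q i≡1+t Qi) ¬Q[1+t])
                             , (λ i≤z → contradiction (≤-trans (≤-reflexive (sym i≡1+t)) (≤-trans i≤z z≤t)) 1+n≰n)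

module Durfee (r : ℕ → ℕ) (antitone : ∀ i → r (suc (suc i)) ≤ r (suc i)) {t z}
         (column≡z : count (λ i → suc z ≤? r i) t ≡ z) where

  private
    downward : ∀ i → 1 ≤ i → suc z ≤ r (suc i) → suc z ≤ r i
    downward (suc i) _ 1+z≤r = ≤-trans 1+z≤r (antitone i)

    threshold = count-threshold (λ i → suc z ≤? r i) downward t column≡z

  1+z≰r[1+z] : suc z ≤ t → ¬ (suc z ≤ r (suc z))
  1+z≰r[1+z] 1+z≤t 1+z≤r = 1+n≰n (proj₁ (threshold (suc z) (s≤s z≤n) 1+z≤t) 1+z≤r)

  diagonal≡z : count (λ i → i ≤? r i) t ≡ z
  diagonal≡z = trans (count-cong (λ i → i ≤? r i) (λ i → suc z ≤? r i) t
                                 on-diagonal⇒in-column in-column⇒on-diagonal)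
                     column≡z
    where
    on-diagonal⇒in-column : ∀ i → 1 ≤ i → i ≤ t → i ≤ r i → suc z ≤ r i
    on-diagonal⇒in-column i 1≤i i≤t i≤r with i ≤? z
    ... | yes i≤z = proj₂ (threshold i 1≤i i≤t) i≤z
    ... | no  i≰z = ≤-trans (≰⇒> i≰z) i≤r
    in-column⇒on-diagonal : ∀ i → 1 ≤ i → i ≤ t → suc z ≤ r i → i ≤ r i
    in-column⇒on-diagonal i 1≤i i≤t 1+z≤r = ≤-trans (m≤n⇒m≤1+n (proj₁ (threshold i 1≤i i≤t) 1+z≤r)) 1+z≤r

lemma3p5 : (k : ℕ) → 4 ≤ k → (λs : List ℕ) → InUbar (T (2 * k ∸ 1)) λs →
    (z : ℕ) → InY λs 1 (suc z) → hook λs 1 (suc z) ≡ (2 * k ∸ 1) ∸ 2 →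
    (¬ InY λs (suc z) (suc z)) × (colLen λs (suc z) ≡ z) × (diagLen λs ≡ z)
lemma3p5 k@(suc (suc (suc (suc j)))) (s≤s (s≤s (s≤s (s≤s _))))
         λs ubar@(((dp , _) , _) , missing≡) z (_ , 1≤t , _ , 1+z≤row₁) hook≡ =
    (λ (_ , 1+z≤t , _ , 1+z≤row) → 1+z≰r[1+z] 1+z≤t 1+z≤row) , column≡z , diagonal≡z
  where
  -- Once k = 4 + j, the terms 2 * k ∸ 1 and (2 * k ∸ 1) ∸ 2 reduce to 2 + p and p.
  p = 2 * k ∸ 3
  4≤p : 4 ≤ p
  4≤p = s≤s (≤-trans (s≤s (s≤s (s≤s z≤n))) (m≤n+m _ j))
  antitone = rowLen-antitone (IsDistinctPartition.increasing dp)
  row₁≡1+p : rowLen λs 1 ≡ suc p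
  row₁≡1+p = trans (rowLen[1]≡1+missing dp) (cong suc (trans missing≡ (⌊largest/2⌋≡p 4≤p ubar)))
  z≤p : z ≤ p
  z≤p = ≤-pred (≤-trans 1+z≤row₁ (≤-reflexive row₁≡1+p))
  column≡z : colLen λs (suc z) ≡ z
  column≡z = +-cancelˡ-≡ (p ∸ z) _ _ (begin
    p ∸ z + colLen λs (suc z)                ≡⟨ cong (λ w → w ∸ suc z + colLen λs (suc z)) (sym row₁≡1+p) ⟩
    rowLen λs 1 ∸ suc z + colLen λs (suc z)  ≡⟨ sym (hook[1,j]≡arm+colLen {λs} 1≤t 1+z≤row₁) ⟩
    hook λs 1 (suc z)                        ≡⟨ hook≡ ⟩
    p                                        ≡⟨ sym (m∸n+n≡m z≤p) ⟩
    p ∸ z + z                                ∎)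
    where open ≡-Reasoning
  open Durfee (rowLen λs) antitone {numRows λs} column≡z
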